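{- Let $N$ be a square-free positive integer that is a congruent number, and let $\alpha_1/\alpha_2$ and $\beta_1/\beta_2$ be the legs of a right triangle with rational sides and area $N$, where $\alpha_1,\alpha_2,\beta_1,\beta_2$ are positive integers with $\gcd(\alpha_1,\alpha_2)=\gcd(\beta_1,\beta_2)=1$. Let $P>Q$ be relatively prime positive integers such that $\alpha_1\beta_2=P^2-Q^2$ and $\alpha_2\beta_1=2PQ$. Then there exist positive integers $P_0,P_1,Q_0,Q_1$ with $P=P_0P_1^2$, $Q=Q_0Q_1^2$, and $P_0Q_0\mid N$.
   Context: A congruent number is a positive integer that is the area of a right triangle with rational sides. The area condition means $\frac{\alpha_1}{\alpha_2}\cdot\frac{\beta_1}{\beta_2}=2N$. Setting $A=\alpha_1\beta_2$, $B=\alpha_2\beta_1$, one has $A^2+B^2=C^2$ for an integer $C$, and $(A,B,C)$ is a primitive Pythagorean triple, parametrized as $A=P^2-Q^2$, $B=2PQ$, $C=P^2+Q^2$ with $P,Q$ coprime. -}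

module Defs where

open import Data.Nat using (ℕ; _*_)
open import Data.Nat.Divisibility using (_∣_)
open import Relation.Binary.PropositionalEquality using (_≡_)

SquareFree : ℕ → Set
SquareFree n = ∀ d → d * d ∣ n → d ≡ 1

-- The area and the parametrisation of the legs give N (α₂β₂)² = P · Q · (P² − Q²),
-- whose three right-hand factors are pairwise coprime. Whenever x is coprime to y
-- and x y = n m², put g = gcd(x, n): then x/g is coprime to n/g, so it divides m²
-- with a cofactor dividing y, hence coprime to x/g; so x/g is a square. Applied to
-- x = P and x = Q this gives P₀ = gcd(P, N) and Q₀ = gcd(Q, N), coprime divisors
-- of N, so P₀ Q₀ ∣ N.
module Submission where

open import Defs
open import Data.List using (_∷_; [])
open import Data.Nat using (ℕ; _+_; _*_; _^_; _<_; NonZero)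
open import Data.Nat.Base using (≢-nonZero; ≢-nonZero⁻¹; >-nonZero; >-nonZero⁻¹)
open import Data.Nat.Properties using (*-comm; *-assoc; *-identityʳ; <-trans; *-cancelˡ-≡; m*n≢0⇒m≢0;
  [m*n]*[o*p]≡[m*o]*[n*p]; *-commutativeSemigroup)
open import Algebra.Properties.CommutativeSemigroup *-commutativeSemigroup using (x∙yz≈y∙xz)
open import Data.Nat.Divisibility
open import Data.Nat.DivMod using (_/_; m*[n/m]≡n)
open import Data.Nat.Coprimality using (Coprime; coprime-divisor; coprime-/gcd)
  renaming (sym to coprime-sym)
open import Data.Nat.GCD using (gcd; gcd[m,n]∣m; gcd[m,n]∣n; gcd[m,n]≢0; m/gcd[m,n]≢0)
open import Data.Nat.Tactic.RingSolver using (solve)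
open import Data.Product using (_×_; ∃-syntax; _,_; proj₁; proj₂)
open import Data.Sum using (inj₁)
open import Relation.Binary.PropositionalEquality

n^2≡n*n : ∀ n → n ^ 2 ≡ n * n
n^2≡n*n n = cong (n *_) (*-identityʳ n)

coprime-∣ˡ : ∀ {a b c} → Coprime a b → c ∣ a → Coprime c b
coprime-∣ˡ a⊥b c∣a (i∣c , i∣b) = a⊥b (∣-trans i∣c c∣a , i∣b)

coprime-∣ʳ : ∀ {a b c} → Coprime a b → c ∣ b → Coprime a c
coprime-∣ʳ a⊥b c∣b (i∣a , i∣c) = a⊥b (i∣a , ∣-trans i∣c c∣b)

coprime-*ʳ : ∀ {a b c} → Coprime a b → Coprime a c → Coprime a (b * c)
coprime-*ʳ a⊥b a⊥c (i∣a , i∣bc) = a⊥c (i∣a , coprime-divisor (coprime-∣ˡ a⊥b i∣a) i∣bc)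

coprime⇒*∣ : ∀ {a b n} → Coprime a b → a ∣ n → b ∣ n → a * b ∣ n
coprime⇒*∣ {a} {b} a⊥b (divides s refl) b∣sa =
  subst (_∣ s * a) (*-comm b a)
    (*-monoˡ-∣ a (coprime-divisor (coprime-sym a⊥b) (subst (b ∣_) (*-comm s a) b∣sa)))

coprime-by-square-difference : ∀ {p q r} → Coprime p q → r + q * q ≡ p * p →
                               Coprime p r × Coprime q r
coprime-by-square-difference {p} {q} {r} p⊥q r+qq≡pp = p⊥r , q⊥r
  where
  p⊥r : Coprime p r
  p⊥r {i} (i∣p , i∣r) =
    coprime-*ʳ p⊥q p⊥q (i∣p , ∣m+n∣m⇒∣n (subst (i ∣_) (sym r+qq≡pp) (∣m⇒∣m*n p i∣p)) i∣r)
  q⊥r : Coprime q r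
  q⊥r {i} (i∣q , i∣r) =
    coprime-*ʳ (coprime-sym p⊥q) (coprime-sym p⊥q)
      (i∣q , subst (i ∣_) r+qq≡pp (∣m∣n⇒∣m+n i∣r (∣m⇒∣m*n q i∣q)))

-- With e = gcd(a, c), a = e a′ and c = e c′ give a′ b = e c′², whence a′ ∣ e
-- (as a′ ⊥ c′) and e ∣ a′ (as e ⊥ b).
coprime-*≡square⇒square : ∀ {a b c} .{{_ : NonZero a}} → Coprime a b → a * b ≡ c * c →
                          ∃[ e ] a ≡ e * e
coprime-*≡square⇒square {a} {b} {c} a⊥b ab≡cc = e , trans a≡ea′ (cong (e *_) a′≡e)
  where
  e = gcd a c
  instance
    e≢0 : NonZero e
    e≢0 = ≢-nonZero (gcd[m,n]≢0 a c (inj₁ (≢-nonZero⁻¹ a)))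
  a′ = a / e
  c′ = c / e
  a≡ea′ : a ≡ e * a′
  a≡ea′ = sym (m*[n/m]≡n (gcd[m,n]∣m a c))
  c≡ec′ : c ≡ e * c′
  c≡ec′ = sym (m*[n/m]≡n (gcd[m,n]∣n a c))
  a′b≡ec′c′ : a′ * b ≡ e * (c′ * c′)
  a′b≡ec′c′ = *-cancelˡ-≡ _ _ e (begin
    e * (a′ * b)       ≡⟨ *-assoc e a′ b ⟨
    e * a′ * b         ≡⟨ cong (_* b) a≡ea′ ⟨
    a * b              ≡⟨ ab≡cc ⟩
    c * c              ≡⟨ cong₂ _*_ c≡ec′ c≡ec′ ⟩
    e * c′ * (e * c′)  ≡⟨ [m*n]*[o*p]≡[m*o]*[n*p] e c′ e c′ ⟩
    e * e * (c′ * c′)  ≡⟨ *-assoc e e (c′ * c′) ⟩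
    e * (e * (c′ * c′)) ∎)
    where open ≡-Reasoning
  a′∣e : a′ ∣ e
  a′∣e = coprime-divisor (coprime-*ʳ a′⊥c′ a′⊥c′)
           (divides b (trans (*-comm (c′ * c′) e) (trans (sym a′b≡ec′c′) (*-comm a′ b))))
    where a′⊥c′ = coprime-/gcd a c
  e∣a′ : e ∣ a′
  e∣a′ = coprime-divisor (coprime-∣ˡ a⊥b (gcd[m,n]∣m a c))
           (divides (c′ * c′) (trans (*-comm b a′) (trans a′b≡ec′c′ (*-comm e (c′ * c′)))))
  a′≡e : a′ ≡ e
  a′≡e = ∣-antisym a′∣e e∣a′

DivisorTimesSquare : ℕ → ℕ → Set
DivisorTimesSquare n x = ∃[ g ] ∃[ e ] (0 < g × 0 < e × x ≡ g * e ^ 2 × g ∣ n)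

coprime-*≡n*square⇒square : ∀ {x y n m} .{{_ : NonZero x}} → Coprime x y → Coprime x n →
                            x * y ≡ n * (m * m) → ∃[ e ] x ≡ e * e
coprime-*≡n*square⇒square {x} {y} {n} {m} x⊥y x⊥n xy≡nmm =
  coprime-*≡square⇒square {c = m} x⊥k (trans (*-comm x k) (sym mm≡kx))
  where
  x∣mm : x ∣ m * m
  x∣mm = coprime-divisor x⊥n (divides y (trans (sym xy≡nmm) (*-comm x y)))
  k = quotient x∣mm
  mm≡kx : m * m ≡ k * x
  mm≡kx = m∣n⇒n≡quotient*m x∣mm
  y≡nk : y ≡ n * k
  y≡nk = *-cancelˡ-≡ _ _ x (begin
    x * y        ≡⟨ xy≡nmm ⟩
    n * (m * m)  ≡⟨ cong (n *_) mm≡kx ⟩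
    n * (k * x)  ≡⟨ *-assoc n k x ⟨
    n * k * x    ≡⟨ *-comm (n * k) x ⟩
    x * (n * k)  ∎)
    where open ≡-Reasoning
  x⊥k : Coprime x k
  x⊥k = coprime-∣ʳ x⊥y (divides n y≡nk)

*≡n*square⇒divisor*square : ∀ {x y n m} .{{_ : NonZero x}} → Coprime x y →
                            x * y ≡ n * (m * m) → DivisorTimesSquare n x
*≡n*square⇒divisor*square {x} {y} {n} {m} x⊥y xy≡nmm =
  g , e , >-nonZero⁻¹ g , >-nonZero⁻¹ e {{m*n≢0⇒m≢0 e}} , x≡ge² , gcd[m,n]∣n x n
  where
  g = gcd x n
  instance
    g≢0 : NonZero g
    g≢0 = ≢-nonZero (gcd[m,n]≢0 x n (inj₁ (≢-nonZero⁻¹ x)))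
  x′ = x / g
  n′ = n / g
  x≡gx′ : x ≡ g * x′
  x≡gx′ = sym (m*[n/m]≡n (gcd[m,n]∣m x n))
  n≡gn′ : n ≡ g * n′
  n≡gn′ = sym (m*[n/m]≡n (gcd[m,n]∣n x n))
  x′y≡n′mm : x′ * y ≡ n′ * (m * m)
  x′y≡n′mm = *-cancelˡ-≡ _ _ g (begin
    g * (x′ * y)        ≡⟨ *-assoc g x′ y ⟨
    g * x′ * y          ≡⟨ cong (_* y) x≡gx′ ⟨
    x * y               ≡⟨ xy≡nmm ⟩
    n * (m * m)         ≡⟨ cong (_* (m * m)) n≡gn′ ⟩
    g * n′ * (m * m)    ≡⟨ *-assoc g n′ (m * m) ⟩
    g * (n′ * (m * m))  ∎)
    where open ≡-Reasoning
  instance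
    x′≢0 : NonZero x′
    x′≢0 = ≢-nonZero (m/gcd[m,n]≢0 x n)
  square : ∃[ e ] x′ ≡ e * e
  square = coprime-*≡n*square⇒square {m = m} (coprime-∣ˡ x⊥y (m/n∣m (gcd[m,n]∣m x n)))
             (coprime-/gcd x n) x′y≡n′mm
  e = proj₁ square
  x′≡ee : x′ ≡ e * e
  x′≡ee = proj₂ square
  instance
    ee≢0 : NonZero (e * e)
    ee≢0 = subst NonZero x′≡ee x′≢0
  x≡ge² : x ≡ g * e ^ 2
  x≡ge² = trans x≡gx′ (cong (g *_) (trans x′≡ee (sym (n^2≡n*n e))))

area-identity : ∀ n a₁ a₂ b₁ b₂ p q → a₁ * b₁ ≡ 2 * n * (a₂ * b₂) → a₂ * b₁ ≡ 2 * p * q →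
                n * (a₂ * b₂ * (a₂ * b₂)) ≡ p * (q * (a₁ * b₂))
area-identity n a₁ a₂ b₁ b₂ p q a₁b₁≡2nm a₂b₁≡2pq = *-cancelˡ-≡ _ _ 2 (begin
  2 * (n * (a₂ * b₂ * (a₂ * b₂)))  ≡⟨ solve (n ∷ a₂ ∷ b₂ ∷ []) ⟩
  2 * n * (a₂ * b₂) * (a₂ * b₂)    ≡⟨ cong (_* (a₂ * b₂)) a₁b₁≡2nm ⟨
  a₁ * b₁ * (a₂ * b₂)              ≡⟨ solve (a₁ ∷ a₂ ∷ b₁ ∷ b₂ ∷ []) ⟩
  a₂ * b₁ * (a₁ * b₂)              ≡⟨ cong (_* (a₁ * b₂)) a₂b₁≡2pq ⟩
  2 * p * q * (a₁ * b₂)            ≡⟨ solve (p ∷ q ∷ a₁ ∷ b₂ ∷ []) ⟩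
  2 * (p * (q * (a₁ * b₂)))        ∎)
  where open ≡-Reasoning

theorem3 : (N α₁ α₂ β₁ β₂ γ₁ γ₂ P Q : ℕ) →
    0 < N → SquareFree N →
    0 < α₁ → 0 < α₂ → 0 < β₁ → 0 < β₂ → 0 < γ₁ → 0 < γ₂ →
    Coprime α₁ α₂ → Coprime β₁ β₂ →
    (α₁ ^ 2 * β₂ ^ 2 + β₁ ^ 2 * α₂ ^ 2) * γ₂ ^ 2 ≡ γ₁ ^ 2 * (α₂ ^ 2 * β₂ ^ 2) →
    α₁ * β₁ ≡ 2 * N * (α₂ * β₂) →
    0 < Q → Q < P → Coprime P Q →
    α₁ * β₂ + Q ^ 2 ≡ P ^ 2 →
    α₂ * β₁ ≡ 2 * P * Q →
    ∃[ P₀ ] ∃[ P₁ ] ∃[ Q₀ ] ∃[ Q₁ ]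
      (0 < P₀ × 0 < P₁ × 0 < Q₀ × 0 < Q₁ ×
       P ≡ P₀ * P₁ ^ 2 × Q ≡ Q₀ * Q₁ ^ 2 × P₀ * Q₀ ∣ N)
theorem3 N α₁ α₂ β₁ β₂ γ₁ γ₂ P Q _ _ _ _ _ _ _ _ _ _ _ area 0<Q Q<P P⊥Q R+Q²≡P² α₂β₁≡2PQ =
  combine (*≡n*square⇒divisor*square {m = m} (coprime-*ʳ P⊥Q P⊥R) (sym NmmPQR))
          (*≡n*square⇒divisor*square {m = m} (coprime-*ʳ (coprime-sym P⊥Q) Q⊥R) (sym NmmQPR))
  where
  instance
    P≢0 : NonZero P
    P≢0 = >-nonZero (<-trans 0<Q Q<P)
    Q≢0 : NonZero Q
    Q≢0 = >-nonZero 0<Q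
  R = α₁ * β₂
  m = α₂ * β₂
  NmmPQR : N * (m * m) ≡ P * (Q * R)
  NmmPQR = area-identity N α₁ α₂ β₁ β₂ P Q area α₂β₁≡2PQ
  NmmQPR : N * (m * m) ≡ Q * (P * R)
  NmmQPR = trans NmmPQR (x∙yz≈y∙xz P Q R)
  legs-coprime : Coprime P R × Coprime Q R
  legs-coprime = coprime-by-square-difference P⊥Q
                   (subst₂ (λ q² p² → R + q² ≡ p²) (n^2≡n*n Q) (n^2≡n*n P) R+Q²≡P²)
  P⊥R = proj₁ legs-coprime
  Q⊥R = proj₂ legs-coprime
  combine : DivisorTimesSquare N P → DivisorTimesSquare N Q →
            ∃[ P₀ ] ∃[ P₁ ] ∃[ Q₀ ] ∃[ Q₁ ]
              (0 < P₀ × 0 < P₁ × 0 < Q₀ × 0 < Q₁ ×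
               P ≡ P₀ * P₁ ^ 2 × Q ≡ Q₀ * Q₁ ^ 2 × P₀ * Q₀ ∣ N)
  combine (P₀ , P₁ , 0<P₀ , 0<P₁ , P≡P₀P₁² , P₀∣N) (Q₀ , Q₁ , 0<Q₀ , 0<Q₁ , Q≡Q₀Q₁² , Q₀∣N) =
    P₀ , P₁ , Q₀ , Q₁ , 0<P₀ , 0<P₁ , 0<Q₀ , 0<Q₁ , P≡P₀P₁² , Q≡Q₀Q₁² ,
    coprime⇒*∣ (coprime-∣ʳ (coprime-∣ˡ P⊥Q P₀∣P) Q₀∣Q) P₀∣N Q₀∣N
    where
    P₀∣P = subst (P₀ ∣_) (sym P≡P₀P₁²) (m∣m*n (P₁ ^ 2))
    Q₀∣Q = subst (Q₀ ∣_) (sym Q≡Q₀Q₁²) (m∣m*n (Q₁ ^ 2))
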